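{- Let $n$ be an odd integer, $k$ an integer with $1 \leq k \leq \lfloor n/2 \rfloor - 1$, $m = (n-2k-1)/2$, and let $G_{n,k}$ be the convex geometric graph defined in the context. For every edge $e \in E(G_{n,k})$, the open arc $Arc_e$ contains at least $m$ vertices of $V(G)$.
   Context: Let $P$ be a regular $2n$-gon inscribed in a circle, whose vertices are labelled cyclically by $-n+1,\dots,0,\dots,n$; labels are taken modulo $2n$ with representatives in $\{ -n+1,\dots,n\}$ (e.g. the vertex labelled $t$ is the point at angle $\pi t/n$). For odd $n$, the vertex set $V(G)$ is the set of the $n$ even-labelled vertices of $P$. An edge $\{a,b\}$ is in direction $i$ if $a+b \equiv 2i \pmod{2n}$. For an integer $i$ and an integer $j$ with $0 \leq j \leq n-2k$ and $j \equiv i \pmod 2$, let $B_{i,j} = \{\,\{i-d,\,i+d\} : d = n-2k-j+1+2t,\ t=0,\dots,k-1\,\}$ (labels mod $2n$): the $k$ consecutive edges in direction $i$ such that exactly $j$ vertices of $V(G)$ lie in the open arc cut off by the extreme edges on the side not containing vertex $i$. The graph $G_{n,k}$ has vertex set $V(G)$ and edge set $\bigcup_{j=-(m+1)}^{m+1} B_{j,|j|} \cup \bigcup_{i=0}^{2k+1} B_{m+i,\,m+\epsilon_i}$, where $\epsilon_i=0$ for even $i$ and $\epsilon_i=1$ for odd $i$. For an edge $e$, its endpoints divide the circle into two open arcs; $Arc_e$ denotes the one not containing the point of $P$ labelled $n$ (equivalently, not containing the open boundary edge between the vertices $n-1$ and $-(n-1)$). -}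

module Defs where

open import Data.Nat as ℕ using (ℕ; zero; suc)
open import Data.Integer as ℤ using (ℤ; +_; _-_; _⊓_; _⊔_; ∣_∣; _%ℕ_)
open import Data.Integer.Properties using (_<?_)
open import Data.List using (List; map; upTo; filter; length)
open import Data.Product using (Σ; _×_; _,_; ∃-syntax)
open import Data.Product.Properties using ()
open import Data.Sum using (_⊎_)
open import Relation.Nullary.Decidable using (_×-dec_)
open import Relation.Binary.PropositionalEquality using (_≡_)

-- Labels of the regular 2n-gon are integers taken modulo 2n.
-- 'rep n t' is the representative of t in {-n+1, ..., n}
-- (for n ≥ 1; the case n = 0 is irrelevant and returns t).
rep : ℕ → ℤ → ℤ
rep zero    t = t
rep (suc p) t =
  (+ ((t ℤ.+ + p) %ℕ (2 ℕ.* suc p))) - + p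

-- V(G) for odd n: the n even labels -(n-1), -(n-1)+2, ..., n-1.
vertices : ℕ → List ℤ
vertices n = map (λ i → + (2 ℕ.* i) - + (n ℕ.∸ 1)) (upTo n)

mOf : ℕ → ℕ → ℕ
mOf n k = (n ℕ.∸ 2 ℕ.* k ℕ.∸ 1) ℕ./ 2

ε : ℕ → ℕ
ε i = i ℕ.% 2

InBOrd : ℕ → ℕ → ℤ → ℤ → ℤ → ℤ → Set
InBOrd n k i j a b =
  ∃[ t ] (t ℕ.< k ×
    (let d = + n - + (2 ℕ.* k) - j ℤ.+ + 1 ℤ.+ + (2 ℕ.* t)
     in (a ≡ rep n (i - d)) × (b ≡ rep n (i ℤ.+ d))))

InB : ℕ → ℕ → ℤ → ℤ → ℤ → ℤ → Set
InB n k i j a b = InBOrd n k i j a b ⊎ InBOrd n k i j b a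

IsEdge : ℕ → ℕ → ℤ → ℤ → Set
IsEdge n k a b =
  (∃[ j ] ((ℤ.- + (mOf n k ℕ.+ 1) ℤ.≤ j) × (j ℤ.≤ + (mOf n k ℕ.+ 1))
           × InB n k j (+ ∣ j ∣) a b))
  ⊎
  (∃[ i ] (i ℕ.≤ 2 ℕ.* k ℕ.+ 1
           × InB n k (+ (mOf n k ℕ.+ i)) (+ (mOf n k ℕ.+ ε i)) a b))

-- For labels a, b given by their representatives in {-n+1,...,n}, both
-- different from n, the open arc between them not containing the point
-- labelled n consists exactly of the labels strictly between min(a,b)
-- and max(a,b).
InArc : ℤ → ℤ → ℤ → Set
InArc a b v = ((a ⊓ b) ℤ.< v) × (v ℤ.< (a ⊔ b))

arcCount : ℕ → ℤ → ℤ → ℕ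
arcCount n a b =
  length (filter (λ v → ((a ⊓ b) <? v) ×-dec (v <? (a ⊔ b))) (vertices n))

module Submission where

-- Write n = 2(m+k)+1 and p = n-1 = 2(m+k).  The vertex set is read off in "vertex
-- coordinates": the a-th vertex (a < n) carries the label 2a-p.  The proof has three layers.
--   1. Vertex coordinates.  'rep' fixes every vertex label and identifies x+2n with x;
--      between the vertices a < b the open arc avoiding n contains exactly the vertices
--      a+1, …, b-1, so it holds at least c of them as soon as a + c < b  ('arc-between').
--   2. Chords.  If the two endpoints of an edge reduce to vertices a and b with a + c < b,
--      in either order, its arc holds c vertices ('chord-direct', 'chord-wrapped').
--   3. Edges of G_{n,k}.  After writing the endpoints i ∓ d of an edge of B_{i,j} as
--      differences of naturals ('lower-end', 'upper-end'), each of the four kinds of edge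
--      (family 1 with j ≥ 0 or j < 0, family 2 with or without passing the label n)
--      is located on explicit vertices by ring identities in ℕ, and the gap a + m < b
--      follows from the parameter ranges ('family1-nonneg', 'family1-neg',
--      'family2-direct', 'family2-wrapped', each an instance of 'EdgeLong').

open import Defs
open import Data.Nat using (ℕ; zero; suc; _≤_; _<_; _+_; _*_; _∸_; _%_; _/_; z≤n; s≤s)
import Data.Nat.Properties as ℕP
open import Data.Nat.DivMod using (m<n⇒m%n≡m; [m+n]%n≡m%n; m≡m%n+[m/n]*n; m%n<n; m*n/n≡m)
open import Data.Nat.Tactic.RingSolver using (solve)
open import Data.Integer as ℤ using (ℤ; +_; _-_; _⊓_; _⊔_; ∣_∣; -[1+_])
import Data.Integer.Properties as ℤP
import Data.Integer.Tactic.RingSolver as ℤSolver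
open import Data.List using ([]; _∷_; applyUpTo; filter; length)
open import Data.List.Properties using (map-applyUpTo; filter-accept)
open import Data.Product using (_×_; _,_; ∃-syntax)
open import Data.Sum using (inj₁; inj₂)
open import Function using (_∘_; id)
open import Relation.Nullary using (yes; no)
open import Relation.Nullary.Decidable using (_×-dec_)
open import Relation.Unary using (Pred; Decidable)
open import Relation.Binary.PropositionalEquality

≤-of-sum : ∀ {a b} s → a + s ≡ b → a ≤ b
≤-of-sum {a} s eq = ℕP.m+n≤o⇒m≤o a (ℕP.≤-reflexive eq)

gap-< : ∀ {a b} c → a + c < b → a < b
gap-< {a} c gap = ℕP.m+n≤o⇒m≤o (suc a) gap

≤-by-excess : ∀ {a b x y} → a + x ≡ b + y → y ≤ x → a ≤ b
≤-by-excess {a} {b} {x} {y} eq y≤x =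
  ℕP.+-cancelʳ-≤ y a b (ℕP.≤-trans (ℕP.+-monoʳ-≤ a y≤x) (ℕP.≤-reflexive eq))

shift-diff : ∀ (x y z : ℤ) → x - y ≡ (x ℤ.+ z) - (y ℤ.+ z)
shift-diff = ℤSolver.solve-∀

unshift-diff : ∀ (x y z : ℤ) → (x ℤ.+ y) - (y ℤ.+ z) ≡ x - z
unshift-diff = ℤSolver.solve-∀

sub-add : ∀ (x y : ℤ) → x - y ℤ.+ y ≡ x
sub-add = ℤSolver.solve-∀

diff-≡ : ∀ {a b c d} → a + d ≡ c + b → + a - + b ≡ + c - + d
diff-≡ {a} {b} {c} {d} eq = begin
  + a - + b                     ≡⟨ shift-diff (+ a) (+ b) (+ d) ⟩
  (+ a ℤ.+ + d) - (+ b ℤ.+ + d) ≡⟨ cong (_- (+ b ℤ.+ + d)) (sym (ℤP.pos-+ a d)) ⟩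
  + (a + d) - (+ b ℤ.+ + d)     ≡⟨ cong (λ x → + x - (+ b ℤ.+ + d)) eq ⟩
  + (c + b) - (+ b ℤ.+ + d)     ≡⟨ cong (_- (+ b ℤ.+ + d)) (ℤP.pos-+ c b) ⟩
  (+ c ℤ.+ + b) - (+ b ℤ.+ + d) ≡⟨ unshift-diff (+ c) (+ b) (+ d) ⟩
  + c - + d                     ∎
  where open ≡-Reasoning

-- The a-th vertex of V(G) in the 2n-gon with n = suc p; 'vertices (suc p)' lists
-- vtx p 0, …, vtx p p.
vtx : ℕ → ℕ → ℤ
vtx p a = + (2 * a) - + p

vtx-< : ∀ p {a b} → a < b → vtx p a ℤ.< vtx p b
vtx-< p a<b = ℤP.+-monoˡ-< (ℤ.- + p) (ℤ.+<+ (ℕP.*-monoʳ-< 2 a<b))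

rep-vtx : ∀ p {a} → a < suc p → rep (suc p) (vtx p a) ≡ vtx p a
rep-vtx p {a} a<n =
  trans (cong (λ x → + (x ℤ.%ℕ (2 * suc p)) - + p) (sub-add (+ (2 * a)) (+ p)))
        (cong (λ r → + r - + p) (m<n⇒m%n≡m (ℕP.*-monoʳ-< 2 a<n)))

rep-vtx-wrap : ∀ p {a} → a < suc p → rep (suc p) (vtx p (a + suc p)) ≡ vtx p a
rep-vtx-wrap p {a} a<n = begin
  rep (suc p) (vtx p (a + suc p))
    ≡⟨ cong (λ x → + (x ℤ.%ℕ (2 * suc p)) - + p) (sub-add (+ (2 * (a + suc p))) (+ p)) ⟩
  + ((2 * (a + suc p)) % (2 * suc p)) - + p
    ≡⟨ cong (λ x → + (x % (2 * suc p)) - + p) (ℕP.*-distribˡ-+ 2 a (suc p)) ⟩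
  + ((2 * a + 2 * suc p) % (2 * suc p)) - + p
    ≡⟨ cong (λ r → + r - + p) ([m+n]%n≡m%n (2 * a) (2 * suc p)) ⟩
  + ((2 * a) % (2 * suc p)) - + p
    ≡⟨ cong (λ r → + r - + p) (m<n⇒m%n≡m (ℕP.*-monoʳ-< 2 a<n)) ⟩
  vtx p a ∎
  where open ≡-Reasoning

length-filter-∷ : ∀ {ℓ} {A : Set} {P : Pred A ℓ} (P? : Decidable P) x xs →
                  length (filter P? xs) ≤ length (filter P? (x ∷ xs))
length-filter-∷ P? x xs with P? x
... | yes _ = ℕP.n≤1+n _
... | no _  = ℕP.≤-refl

count-run : ∀ {ℓ} {A : Set} {P : Pred A ℓ} (P? : Decidable P) (f : ℕ → A) {n} s c →
            s + c ≤ n → (∀ i → s ≤ i → i < s + c → P (f i)) →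
            c ≤ length (filter P? (applyUpTo f n))
count-run P? f zero zero _ _ = z≤n
count-run P? f {suc n} zero (suc c) (s≤s c≤n) run
  rewrite filter-accept P? {xs = applyUpTo (f ∘ suc) n} (run 0 z≤n (s≤s z≤n)) =
  s≤s (count-run P? (f ∘ suc) zero c c≤n (λ i _ i<c → run (suc i) z≤n (s≤s i<c)))
count-run P? f {suc n} (suc s) c (s≤s s+c≤n) run =
  ℕP.≤-trans (count-run P? (f ∘ suc) s c s+c≤n (λ i s≤i i<s+c → run (suc i) (s≤s s≤i) (s≤s i<s+c)))
             (length-filter-∷ P? (f 0) (applyUpTo (f ∘ suc) n))

arcCount-sym : ∀ n a b → arcCount n a b ≡ arcCount n b a
arcCount-sym n a b rewrite ℤP.⊓-comm a b | ℤP.⊔-comm a b = refl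

arc-between : ∀ p {a b c} → a + c < b → b < suc p → c ≤ arcCount (suc p) (vtx p a) (vtx p b)
arc-between p {a} {b} {c} gap b<n =
  ℕP.≤-trans (count-run between? (vtx p) (suc a) c (ℕP.≤-trans gap (ℕP.<⇒≤ b<n)) inside)
             (ℕP.≤-reflexive (cong (length ∘ filter between?) (sym (map-applyUpTo id (vtx p) (suc p)))))
  where
  lo hi : ℤ
  lo = vtx p a ⊓ vtx p b
  hi = vtx p a ⊔ vtx p b
  between? : Decidable (λ v → lo ℤ.< v × v ℤ.< hi)
  between? v = (lo ℤP.<? v) ×-dec (v ℤP.<? hi)
  vtx-a≤b : vtx p a ℤ.≤ vtx p b
  vtx-a≤b = ℤP.<⇒≤ (vtx-< p (gap-< c gap))
  inside : ∀ i → suc a ≤ i → i < suc a + c → lo ℤ.< vtx p i × vtx p i ℤ.< hi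
  inside i a<i i<a+c rewrite ℤP.i≤j⇒i⊓j≡i vtx-a≤b | ℤP.i≤j⇒i⊔j≡j vtx-a≤b =
    vtx-< p a<i , vtx-< p (ℕP.<-≤-trans i<a+c gap)

chord-direct : ∀ p {c} x y a b → x ≡ vtx p a → y ≡ vtx p b → a + c < b → b < suc p →
               c ≤ arcCount (suc p) (rep (suc p) x) (rep (suc p) y)
chord-direct p {c} x y a b refl refl gap b<n =
  subst₂ (λ u v → c ≤ arcCount (suc p) u v)
         (sym (rep-vtx p (ℕP.<-trans (gap-< c gap) b<n))) (sym (rep-vtx p b<n))
         (arc-between p gap b<n)

chord-wrapped : ∀ p {c} x y a b → x ≡ vtx p b → y ≡ vtx p (a + suc p) → a + c < b → b < suc p →
                c ≤ arcCount (suc p) (rep (suc p) x) (rep (suc p) y)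
chord-wrapped p {c} x y a b refl refl gap b<n =
  subst₂ (λ u v → c ≤ arcCount (suc p) u v)
         (sym (rep-vtx p b<n)) (sym (rep-vtx-wrap p (ℕP.<-trans (gap-< c gap) b<n)))
         (subst (c ≤_) (arcCount-sym (suc p) (vtx p a) (vtx p b)) (arc-between p gap b<n))

halfLen : ℕ → ℕ → ℤ → ℕ → ℤ
halfLen n k j t = + n - + (2 * k) - j ℤ.+ + 1 ℤ.+ + (2 * t)

EdgeLong : ℕ → ℕ → ℕ → ℤ → ℤ → ℕ → Set
EdgeLong n k c i j t = c ≤ arcCount n (rep n (i - halfLen n k j t)) (rep n (i ℤ.+ halfLen n k j t))

ChordsLong : ℕ → ℕ → ℕ → ℤ → ℤ → Set
ChordsLong n k c i j = ∀ t → t < k → EdgeLong n k c i j t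

InB-count : ∀ {n k c} {i j} {a b} → ChordsLong n k c i j → InB n k i j a b → c ≤ arcCount n a b
InB-count long (inj₁ (t , t<k , refl , refl)) = long t t<k
InB-count {n} {c = c} long (inj₂ (t , t<k , refl , refl)) =
  subst (c ≤_) (arcCount-sym n _ _) (long t t<k)

-- The endpoints i ∓ d rearranged over ℤ, and the embedding ℕ → ℤ commuting with sums;
-- together they express i ∓ d as a difference of two naturals.
lower-end-ℤ : ∀ (I′ I N K J T : ℤ) →
  (ℤ.- I′ ℤ.+ I) - (N - K - J ℤ.+ + 1 ℤ.+ T) ≡ (I ℤ.+ K ℤ.+ J) - (I′ ℤ.+ N ℤ.+ + 1 ℤ.+ T)
lower-end-ℤ = ℤSolver.solve-∀

upper-end-ℤ : ∀ (I′ I N K J T : ℤ) →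
  (ℤ.- I′ ℤ.+ I) ℤ.+ (N - K - J ℤ.+ + 1 ℤ.+ T) ≡ (I ℤ.+ N ℤ.+ + 1 ℤ.+ T) - (I′ ℤ.+ K ℤ.+ J)
upper-end-ℤ = ℤSolver.solve-∀

pos-+₃ : ∀ a b c → + (a + b + c) ≡ + a ℤ.+ + b ℤ.+ + c
pos-+₃ a b c = trans (ℤP.pos-+ (a + b) c) (cong (ℤ._+ + c) (ℤP.pos-+ a b))

pos-+₄ : ∀ a b c d → + (a + b + c + d) ≡ + a ℤ.+ + b ℤ.+ + c ℤ.+ + d
pos-+₄ a b c d = trans (ℤP.pos-+ (a + b + c) d) (cong (ℤ._+ + d) (pos-+₃ a b c))

lower-end : ∀ I′ I n k J t p a → (I + 2 * k + J) + p ≡ 2 * a + (I′ + n + 1 + 2 * t) →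
            (ℤ.- + I′ ℤ.+ + I) - halfLen n k (+ J) t ≡ vtx p a
lower-end I′ I n k J t p a eq =
  trans (lower-end-ℤ (+ I′) (+ I) (+ n) (+ (2 * k)) (+ J) (+ (2 * t)))
        (trans (sym (cong₂ _-_ (pos-+₃ I (2 * k) J) (pos-+₄ I′ n 1 (2 * t))))
               (diff-≡ {c = 2 * a} {d = p} eq))

upper-end : ∀ I′ I n k J t p a → (I + n + 1 + 2 * t) + p ≡ 2 * a + (I′ + 2 * k + J) →
            (ℤ.- + I′ ℤ.+ + I) ℤ.+ halfLen n k (+ J) t ≡ vtx p a
upper-end I′ I n k J t p a eq =
  trans (upper-end-ℤ (+ I′) (+ I) (+ n) (+ (2 * k)) (+ J) (+ (2 * t)))
        (trans (sym (cong₂ _-_ (pos-+₄ I n 1 (2 * t)) (pos-+₃ I′ (2 * k) J)))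
               (diff-≡ {c = 2 * a} {d = p} eq))

lower-end⁺ : ∀ I n k J t p a → (I + 2 * k + J) + p ≡ 2 * a + (0 + n + 1 + 2 * t) →
             + I - halfLen n k (+ J) t ≡ vtx p a
lower-end⁺ I = lower-end 0 I

upper-end⁺ : ∀ I n k J t p a → (I + n + 1 + 2 * t) + p ≡ 2 * a + (0 + 2 * k + J) →
             + I ℤ.+ halfLen n k (+ J) t ≡ vtx p a
upper-end⁺ I = upper-end 0 I

lower-end⁻ : ∀ I n k J t p a → (0 + 2 * k + J) + p ≡ 2 * a + (suc I + n + 1 + 2 * t) →
             -[1+ I ] - halfLen n k (+ J) t ≡ vtx p a
lower-end⁻ I = lower-end (suc I) 0

upper-end⁻ : ∀ I n k J t p a → (0 + n + 1 + 2 * t) + p ≡ 2 * a + (suc I + 2 * k + J) →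
             -[1+ I ] ℤ.+ halfLen n k (+ J) t ≡ vtx p a
upper-end⁻ I = upper-end (suc I) 0

-- Family 1, direction u ≥ 0 with u ≤ m+1.  With k = t+1+r, the endpoints 2u-2m-2-2t and
-- 2m+2+2t of the t-th edge are the vertices u+r and 2m+2+2t+r, at distance 2m+2+2t-u > m.
family1-nonneg : ∀ m t r u → u ≤ m + 1 →
                 EdgeLong (suc (2 * (m + (suc t + r)))) (suc t + r) m (+ u) (+ u) t
family1-nonneg m t r u u≤m+1 =
  let K = suc t + r; p = 2 * (m + K); N = suc p; a = u + r; b = 2 * m + 2 + 2 * t + r in
  chord-direct p (+ u - halfLen N K (+ u) t) (+ u ℤ.+ halfLen N K (+ u) t) a b
    (lower-end⁺ u N K u t p a (solve (m ∷ t ∷ r ∷ u ∷ [])))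
    (upper-end⁺ u N K u t p b (solve (m ∷ t ∷ r ∷ u ∷ [])))
    (≤-by-excess {x = 2 * t + (m + 1)} {y = u} (solve (m ∷ t ∷ r ∷ u ∷ []))
                 (ℕP.≤-trans u≤m+1 (ℕP.m≤n+m (m + 1) (2 * t))))
    (≤-of-sum {b = N} r (solve (m ∷ t ∷ r ∷ [])))

-- Family 1, direction -(u+1) with u ≤ m, written m = u+w.  With k = t+1+r the endpoints
-- -2m-2-2t and 2m-2u+2t are the vertices r and u+2w+2t+r+1, at distance m+w+2t+1 > m.
family1-neg : ∀ w t r u →
              EdgeLong (suc (2 * ((u + w) + (suc t + r)))) (suc t + r) (u + w) -[1+ u ] (+ suc u) t
family1-neg w t r u =
  let m = u + w; K = suc t + r; p = 2 * (m + K); N = suc p; a = r; b = u + 2 * w + 2 * t + r + 1 in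
  chord-direct p (-[1+ u ] - halfLen N K (+ suc u) t) (-[1+ u ] ℤ.+ halfLen N K (+ suc u) t) a b
    (lower-end⁻ u N K (suc u) t p a (solve (w ∷ t ∷ r ∷ u ∷ [])))
    (upper-end⁻ u N K (suc u) t p b (solve (w ∷ t ∷ r ∷ u ∷ [])))
    (≤-of-sum {b = b} (w + 2 * t) (solve (w ∷ t ∷ r ∷ u ∷ [])))
    (≤-of-sum {b = N} (u + r + 1) (solve (w ∷ t ∷ r ∷ u ∷ [])))

-- Family 2, direction m+e+2h (e ≤ 1), when the t-th edge stays below n: k = h+t+1+r.
-- The endpoints 2h+2e-2-2t and 2m+2h+2+2t are the vertices 2h+e+m+r and 2m+2h+2t+r+2.
family2-direct : ∀ m h t r e → e ≤ 1 →
                 EdgeLong (suc (2 * (m + (suc (h + t) + r)))) (suc (h + t) + r) m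
                          (+ (m + (e + h * 2))) (+ (m + e)) t
family2-direct m h t r e e≤1 =
  let K = suc (h + t) + r; p = 2 * (m + K); N = suc p; I = m + (e + h * 2); J = m + e
      a = h * 2 + e + m + r; b = 2 * m + 2 * h + 2 * t + r + 2 in
  chord-direct p (+ I - halfLen N K (+ J) t) (+ I ℤ.+ halfLen N K (+ J) t) a b
    (lower-end⁺ I N K J t p a (solve (m ∷ h ∷ t ∷ r ∷ e ∷ [])))
    (upper-end⁺ I N K J t p b (solve (m ∷ h ∷ t ∷ r ∷ e ∷ [])))
    (≤-by-excess {x = 1 + 2 * t} {y = e} (solve (m ∷ h ∷ t ∷ r ∷ e ∷ []))
                 (ℕP.≤-trans e≤1 (ℕP.m≤m+n 1 (2 * t))))
    (≤-of-sum {b = N} r (solve (m ∷ h ∷ t ∷ r ∷ [])))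

-- Family 2, direction m+e+2h (e ≤ 1, h ≤ k), when the t-th edge passes n: k = t+1+r and
-- h = r+1+q.  The lower endpoint is the vertex h+e+m+r, the upper one lies a full turn
-- past the vertex q.
family2-wrapped : ∀ m t r q e → e ≤ 1 → suc r + q ≤ suc t + r →
                  EdgeLong (suc (2 * (m + (suc t + r)))) (suc t + r) m
                           (+ (m + (e + (suc r + q) * 2))) (+ (m + e)) t
family2-wrapped m t r q e e≤1 h≤k =
  let K = suc t + r; h = suc r + q; p = 2 * (m + K); N = suc p; I = m + (e + h * 2); J = m + e
      b = h + e + m + r in
  chord-wrapped p (+ I - halfLen N K (+ J) t) (+ I ℤ.+ halfLen N K (+ J) t) q b
    (lower-end⁺ I N K J t p b (solve (m ∷ t ∷ r ∷ q ∷ e ∷ [])))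
    (upper-end⁺ I N K J t p (q + suc p) (solve (m ∷ t ∷ r ∷ q ∷ e ∷ [])))
    (≤-of-sum {b = b} (2 * r + e) (solve (m ∷ t ∷ r ∷ q ∷ e ∷ [])))
    (≤-by-excess {x = m + t + (K + 1)} {y = h + e} (solve (m ∷ t ∷ r ∷ q ∷ e ∷ []))
                 (ℕP.≤-trans (ℕP.+-mono-≤ h≤k e≤1) (ℕP.m≤n+m (K + 1) (m + t))))

family1 : ∀ m k j → ℤ.- + (m + 1) ℤ.≤ j → j ℤ.≤ + (m + 1) →
          ChordsLong (suc (2 * (m + k))) k m j (+ ∣ j ∣)
family1 m k (+ u) _ u≤m+1 t t<k =
  let r , k≡ = ℕP.m≤n⇒∃[o]m+o≡n t<k in
  subst (λ k → EdgeLong (suc (2 * (m + k))) k m (+ u) (+ u) t) k≡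
        (family1-nonneg m t r u (ℤP.drop‿+≤+ u≤m+1))
family1 m k -[1+ u ] -m-1≤j _ t t<k =
  let r , k≡ = ℕP.m≤n⇒∃[o]m+o≡n t<k
      u≤m = ℤP.drop‿-≤- (subst (λ x → ℤ.- + x ℤ.≤ -[1+ u ]) (ℕP.+-comm m 1) -m-1≤j)
      w , m≡ = ℕP.m≤n⇒∃[o]m+o≡n u≤m
  in subst₂ (λ m k → EdgeLong (suc (2 * (m + k))) k m -[1+ u ] (+ suc u) t) m≡ k≡
            (family1-neg w t r u)

wrap-offset : ∀ h t r → suc t + r ≤ h + t → suc r ≤ h
wrap-offset h t r le = ℕP.+-cancelʳ-≤ t (suc r) h (subst (_≤ h + t) (cong suc (ℕP.+-comm t r)) le)

-- Family 2 for the direction m+e+2h with e ≤ 1 and h ≤ k: split on whether the edge passes n.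
family2-parity : ∀ m k h e → e ≤ 1 → h ≤ k →
                 ChordsLong (suc (2 * (m + k))) k m (+ (m + (e + h * 2))) (+ (m + e))
family2-parity m k h e e≤1 h≤k t t<k with h + t ℕP.<? k
... | yes h+t<k =
  let r , k≡ = ℕP.m≤n⇒∃[o]m+o≡n h+t<k in
  subst (λ k → EdgeLong (suc (2 * (m + k))) k m (+ (m + (e + h * 2))) (+ (m + e)) t) k≡
        (family2-direct m h t r e e≤1)
... | no h+t≮k =
  let r , k≡ = ℕP.m≤n⇒∃[o]m+o≡n t<k
      q , h≡ = ℕP.m≤n⇒∃[o]m+o≡n (wrap-offset h t r (subst (_≤ h + t) (sym k≡) (ℕP.≮⇒≥ h+t≮k)))
  in subst₂ (λ h k → EdgeLong (suc (2 * (m + k))) k m (+ (m + (e + h * 2))) (+ (m + e)) t) h≡ k≡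
            (family2-wrapped m t r q e e≤1 (subst₂ _≤_ (sym h≡) (sym k≡) h≤k))

half-≤ : ∀ e h k → e + h * 2 ≤ 2 * k + 1 → h ≤ k
half-≤ e h k le = ℕP.≤-pred (ℕP.*-cancelʳ-< 2 h (suc k)
  (ℕP.≤-<-trans (ℕP.≤-trans (ℕP.m≤n+m (h * 2) e) le) (ℕP.≤-reflexive 2k+2≡)))
  where
  2k+2≡ : suc (2 * k + 1) ≡ suc k * 2
  2k+2≡ = solve (k ∷ [])

family2 : ∀ m k i → i ≤ 2 * k + 1 → ChordsLong (suc (2 * (m + k))) k m (+ (m + i)) (+ (m + ε i))
family2 m k i i≤2k+1 =
  subst (λ x → ChordsLong (suc (2 * (m + k))) k m (+ (m + x)) (+ (m + ε i))) (sym i≡)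
        (family2-parity m k (i / 2) (ε i) (ℕP.≤-pred (m%n<n i 2))
                        (half-≤ (ε i) (i / 2) k (subst (_≤ 2 * k + 1) i≡ i≤2k+1)))
  where
  i≡ : i ≡ ε i + i / 2 * 2
  i≡ = m≡m%n+[m/n]*n i 2

odd-form : ∀ n k → n % 2 ≡ 1 → k ≤ n / 2 ∸ 1 → ∃[ m ] n ≡ suc (2 * (m + k))
odd-form n k n-odd k≤ = n / 2 ∸ k , (begin
  n                           ≡⟨ m≡m%n+[m/n]*n n 2 ⟩
  n % 2 + n / 2 * 2           ≡⟨ cong (_+ n / 2 * 2) n-odd ⟩
  suc (n / 2 * 2)             ≡⟨ cong suc (ℕP.*-comm (n / 2) 2) ⟩
  suc (2 * (n / 2))           ≡⟨ cong (λ x → suc (2 * x)) (sym (ℕP.m∸n+n≡m k≤n/2)) ⟩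
  suc (2 * (n / 2 ∸ k + k))   ∎)
  where
  open ≡-Reasoning
  k≤n/2 : k ≤ n / 2
  k≤n/2 = ℕP.≤-trans k≤ (ℕP.m∸n≤m (n / 2) 1)

mOf-odd : ∀ m k → mOf (suc (2 * (m + k))) k ≡ m
mOf-odd m k = begin
  (suc (2 * (m + k)) ∸ 2 * k ∸ 1) / 2 ≡⟨ cong (λ x → (suc x ∸ 2 * k ∸ 1) / 2) (ℕP.*-distribˡ-+ 2 m k) ⟩
  (suc (2 * m + 2 * k) ∸ 2 * k ∸ 1) / 2 ≡⟨ cong (λ x → (x ∸ 1) / 2) (ℕP.m+n∸n≡m (suc (2 * m)) (2 * k)) ⟩
  (2 * m) / 2                         ≡⟨ cong (_/ 2) (ℕP.*-comm 2 m) ⟩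
  (m * 2) / 2                         ≡⟨ m*n/n≡m m 2 ⟩
  m                                   ∎
  where open ≡-Reasoning

edge-long : ∀ m k a b → IsEdge (suc (2 * (m + k))) k a b → m ≤ arcCount (suc (2 * (m + k))) a b
edge-long m k a b (inj₁ (j , -m-1≤j , j≤m+1 , in-B)) =
  InB-count {suc (2 * (m + k))} {k} {m} {j} {+ ∣ j ∣}
            (family1 m k j (subst (λ x → ℤ.- + (x + 1) ℤ.≤ j) (mOf-odd m k) -m-1≤j)
                           (subst (λ x → j ℤ.≤ + (x + 1)) (mOf-odd m k) j≤m+1))
            in-B
edge-long m k a b (inj₂ (i , i≤2k+1 , in-B)) =
  InB-count {suc (2 * (m + k))} {k} {m} {+ (m + i)} {+ (m + ε i)} (family2 m k i i≤2k+1)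
            (subst (λ x → InB (suc (2 * (m + k))) k (+ (x + i)) (+ (x + ε i)) a b) (mOf-odd m k) in-B)

lemma2 : (n k : ℕ) → n % 2 ≡ 1 → 1 ≤ k → k ≤ n / 2 ∸ 1 →
         (a b : ℤ) → IsEdge n k a b →
         mOf n k ≤ arcCount n a b
lemma2 n k n-odd _ k≤ a b edge =
  let m , n≡ = odd-form n k n-odd k≤ in
  subst (λ n → IsEdge n k a b → mOf n k ≤ arcCount n a b) (sym n≡)
        (λ edge → subst (_≤ arcCount (suc (2 * (m + k))) a b) (sym (mOf-odd m k)) (edge-long m k a b edge))
        edge
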